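{- Let $\underline R$ be an EEC computation type. For every simple type $\sigma$, $\sigma^{lv}=(\sigma^{v})^{\bullet}$ (syntactic identity of types), and consequently $\Theta^{lv}=(\Theta^v)^\bullet$ for every context $\Theta$; and for every simply-typed term $\Theta\vdash M:\sigma$, $$\Theta^{lv}\mid-\vdash M^{lv}=(M^{v})^{\bullet}:(\sigma^{lv}\Rightarrow\underline R)\multimap\underline R$$ holds in EEC.
   Context: **EEC (enriched effect calculus).** There are value-type constants $\alpha,\beta,\ldots$ and a disjoint set of computation-type constants $\underline{\alpha},\underline{\beta},\ldots$. Value types $A,B,C$ and computation types $\underline{A},\underline{B},\underline{C},\underline{D}$ are generated by $A::=\alpha\mid 1\mid A\times B\mid A\to B\mid \underline{A}\mid \underline{A}\multimap\underline{B}$ and $\underline{A}::=\underline{\alpha}\mid\underline{1}\mid\underline{A}\,\&\,\underline{B}\mid A\Rightarrow\underline{B}\mid\underline{I}\mid\ !A\mid\ !A\otimes\underline{B}\mid\underline{0}\mid\underline{A}\oplus\underline{B}$ (every computation type is also a value type; $!A\otimes\underline{B}$ is one primitive binary constructor). Judgements are $\Gamma\mid -\vdash t:A$ and $\Gamma\mid z{:}\underline{A}\vdash t:\underline{B}$, where $\Gamma$ lists distinct variables with value types and the "stoup" holds at most one variable, of computation type; with nonempty stoup the result type is a computation type. Below $\Delta$ is empty or $z{:}\underline{D}$. Typing rules: $\Gamma,x{:}A\mid-\vdash x:A$; $\Gamma\mid-\vdash *:1$; pairs $\langle t,u\rangle:A\times B$, projections $\pi_1t,\pi_2t$; $\lambda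 x{:}A.t:A\to B$ from $\Gamma,x{:}A\mid-\vdash t:B$; application $t\,u$ (all with empty stoup). $\Gamma\mid z{:}\underline A\vdash z:\underline A$; $\Gamma\mid\Delta\vdash\underline{*}:\underline 1$; from $\Gamma\mid\Delta\vdash t:\underline A$, $\Gamma\mid\Delta\vdash u:\underline B$ get $\Gamma\mid\Delta\vdash\langle t,u\rangle_c:\underline A\,\&\,\underline B$, and from $\Gamma\mid\Delta\vdash t:\underline A\,\&\,\underline B$ get $\underline\pi_1t:\underline A$, $\underline\pi_2t:\underline B$; from $\Gamma,x{:}A\mid\Delta\vdash t:\underline B$ get $\Gamma\mid\Delta\vdash\underline\lambda x{:}A.t:A\Rightarrow\underline B$; from $\Gamma\mid\Delta\vdash s:A\Rightarrow\underline B$, $\Gamma\mid-\vdash t:A$ get $\Gamma\mid\Delta\vdash s@t:\underline B$; $\Gamma\mid-\vdash\top:\underline I$; from $\Gamma\mid\Delta\vdash t:\underline I$, $\Gamma\mid-\vdash u:\underline A$ get $\Gamma\mid\Delta\vdash \mathrm{let}\ \top\ \mathrm{be}\ t\ \mathrm{in}\ u:\underline A$; from $\Gamma\mid-\vdash t:A$ get $\Gamma\mid-\vdash\,!t:\,!A$; from $\Gamma\mid\Delta\vdash t:\,!A$, $\Gamma,x{:}A\mid-\vdash u:\underline B$ get $\Gamma\mid\Delta\vdash\mathrm{let}\ !x\ \mathrm{be}\ t\ \mathrm{in}\ u:\underline B$; from $\Gamma\mid-\vdash t:A$, $\Gamma\mid\Delta\vdash u:\underline B$ get $\Gamma\mid\Delta\vdash\,!t\otimes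 u:\,!A\otimes\underline B$; from $\Gamma\mid\Delta\vdash s:\,!A\otimes\underline B$, $\Gamma,x{:}A\mid y{:}\underline B\vdash t:\underline C$ get $\Gamma\mid\Delta\vdash\mathrm{let}\ !x\otimes y\ \mathrm{be}\ s\ \mathrm{in}\ t:\underline C$; from $\Gamma\mid\Delta\vdash t:\underline 0$ get $\Gamma\mid\Delta\vdash\mathrm{abort}_{\underline A}(t):\underline A$; $\mathrm{inl}\,t:\underline A\oplus\underline B$ from $t:\underline A$ and $\mathrm{inr}\,t$ from $t:\underline B$ (same $\Gamma\mid\Delta$); from $\Gamma\mid\Delta\vdash s:\underline A\oplus\underline B$, $\Gamma\mid x{:}\underline A\vdash t:\underline C$, $\Gamma\mid y{:}\underline B\vdash u:\underline C$ get $\Gamma\mid\Delta\vdash\mathrm{case}\ s\ \mathrm{of}\ (\mathrm{inl}\,x\Rightarrow t\mid\mathrm{inr}\,y\Rightarrow u):\underline C$; from $\Gamma\mid z{:}\underline A\vdash t:\underline B$ get $\Gamma\mid-\vdash\hat\lambda z{:}\underline A.t:\underline A\multimap\underline B$; from $\Gamma\mid-\vdash s:\underline A\multimap\underline B$, $\Gamma\mid\Delta\vdash t:\underline A$ get $\Gamma\mid\Delta\vdash s\{t\}:\underline B$. Equality $\Gamma\mid\Delta\vdash t=u:A$ is the least typed congruence (equivalence, compatible with all term formers, containing $\alpha$-equivalence) containing all well-typed instances of: $t=*$ for $t:1$; $\pi_1\langle t,u\rangle=t$, $\pi_2\langle t,u\rangle=u$, $\langle\pi_1t,\pi_2t\rangle=t$;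 $(\lambda x.t)u=t[u/x]$, $\lambda x.(t\,x)=t$ ($x$ not free in $t$); $t=\underline*$ for $t:\underline1$; $\underline\pi_1\langle t,u\rangle_c=t$, $\underline\pi_2\langle t,u\rangle_c=u$, $\langle\underline\pi_1t,\underline\pi_2t\rangle_c=t$; $(\underline\lambda x.t)@u=t[u/x]$, $\underline\lambda x.(t@x)=t$ ($x$ not free); $\mathrm{let}\ \top\ \mathrm{be}\ \top\ \mathrm{in}\ t=t$; $\mathrm{let}\ \top\ \mathrm{be}\ t\ \mathrm{in}\ u[\top/x]=u[t/x]$ for $\Gamma\mid x{:}\underline I\vdash u:\underline A$; $\mathrm{let}\ !x\ \mathrm{be}\ !t\ \mathrm{in}\ u=u[t/x]$; $\mathrm{let}\ !x\ \mathrm{be}\ t\ \mathrm{in}\ u[!x/y]=u[t/y]$ for $\Gamma\mid y{:}\,!A\vdash u:\underline B$; $\mathrm{let}\ !x\otimes y\ \mathrm{be}\ !t\otimes s\ \mathrm{in}\ u=u[t/x,s/y]$; $\mathrm{let}\ !x\otimes y\ \mathrm{be}\ t\ \mathrm{in}\ u[(!x\otimes y)/z]=u[t/z]$ for $\Gamma\mid z{:}\,!A\otimes\underline B\vdash u:\underline C$; $\mathrm{abort}_{\underline A}(t)=u[t/x]$ for $\Gamma\mid x{:}\underline 0\vdash u:\underline A$; $\mathrm{case}\ \mathrm{inl}\,t\ \mathrm{of}\ (\mathrm{inl}\,x\Rightarrow u\mid\mathrm{inr}\,y\Rightarrow u')=u[t/x]$ and symmetrically for $\mathrm{inr}$; $\mathrm{case}\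 t\ \mathrm{of}\ (\mathrm{inl}\,x\Rightarrow u[\mathrm{inl}\,x/z]\mid\mathrm{inr}\,y\Rightarrow u[\mathrm{inr}\,y/z])=u[t/z]$ for $\Gamma\mid z{:}\underline A\oplus\underline B\vdash u:\underline C$; $(\hat\lambda x.t)\{u\}=t[u/x]$, $\hat\lambda x.(t\{x\})=t$ ($x$ not free). **Simply-typed $\lambda$-calculus.** Types $\sigma,\tau::=\alpha\mid 1\mid\sigma\times\tau\mid\sigma\to\tau$; terms $x,*,\langle M,N\rangle,\pi_1M,\pi_2M,\lambda x{:}\sigma.M,M\,N$ with standard typing in contexts $\Theta=x_1{:}\sigma_1,\ldots,x_n{:}\sigma_n$; each $\lambda$-type constant $\alpha$ is also an EEC value-type constant. **Standard cbv translation into EEC.** $\alpha^v=\alpha$, $1^v=1$, $(\sigma\times\tau)^v=\sigma^v\times\tau^v$, $(\sigma\to\tau)^v=\sigma^v\to\,!(\tau^v)$; $\Theta\vdash M:\tau$ goes to $\Theta^v\mid-\vdash M^v:\,!(\tau^v)$ with $x^v=\,!x$; $*^v=\,!*$; $\langle M,N\rangle^v=\mathrm{let}\ !x\ \mathrm{be}\ M^v\ \mathrm{in}\ \mathrm{let}\ !y\ \mathrm{be}\ N^v\ \mathrm{in}\ !\langle x,y\rangle$; $(\pi_1M)^v=\mathrm{let}\ !z\ \mathrm{be}\ M^v\ \mathrm{in}\ !(\pi_1z)$; $(\pi_2M)^v=\mathrm{let}\ !z\ \mathrm{be}\ M^v\ \mathrm{in}\ !(\pi_2z)$; $(\lambda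 x{:}\sigma.M)^v=\,!(\lambda x{:}\sigma^v.M^v)$; $(M\,N)^v=\mathrm{let}\ !f\ \mathrm{be}\ M^v\ \mathrm{in}\ \mathrm{let}\ !x\ \mathrm{be}\ N^v\ \mathrm{in}\ f\,x$. **Linear-use cbv CPS translation** (relative to $\underline R$): $\alpha^{lv}=\alpha$, $1^{lv}=1$, $(\sigma\times\tau)^{lv}=\sigma^{lv}\times\tau^{lv}$, $(\sigma\to\tau)^{lv}=\sigma^{lv}\to((\tau^{lv}\Rightarrow\underline R)\multimap\underline R)$; $\Theta^{lv}=x_1{:}\sigma_1^{lv},\ldots$; $\Theta\vdash M:\tau$ goes to $\Theta^{lv}\mid-\vdash M^{lv}:(\tau^{lv}\Rightarrow\underline R)\multimap\underline R$ with $x^{lv}=\hat\lambda k{:}\sigma^{lv}\Rightarrow\underline R.\,k@x$; $*^{lv}=\hat\lambda k{:}1\Rightarrow\underline R.\,k@*$; $\langle M,N\rangle^{lv}=\hat\lambda k{:}(\sigma^{lv}\times\tau^{lv})\Rightarrow\underline R.\,M^{lv}\{\underline\lambda x{:}\sigma^{lv}.\,N^{lv}\{\underline\lambda y{:}\tau^{lv}.\,k@\langle x,y\rangle\}\}$; $(\pi_1M)^{lv}=\hat\lambda k{:}\sigma^{lv}\Rightarrow\underline R.\,M^{lv}\{\underline\lambda z{:}\sigma^{lv}\times\tau^{lv}.\,k@(\pi_1z)\}$, $(\pi_2M)^{lv}$ analogously; $(\lambda x{:}\sigma.M)^{lv}=\hat\lambda k{:}(\sigma\to\tau)^{lv}\Rightarrow\underline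 R.\,k@(\lambda x{:}\sigma^{lv}.M^{lv})$; $(M\,N)^{lv}=\hat\lambda k{:}\tau^{lv}\Rightarrow\underline R.\,M^{lv}\{\underline\lambda f{:}(\sigma\to\tau)^{lv}.\,N^{lv}\{\underline\lambda x{:}\sigma^{lv}.\,(f\,x)\{k\}\}\}$. **Generic self-translation relative to $\underline R$.** Types: $\alpha^\bullet=\alpha$, $1^\bullet=1$, $(A\times B)^\bullet=A^\bullet\times B^\bullet$, $(A\to B)^\bullet=A^\bullet\to B^\bullet$, $\underline A^\bullet=\underline A^\circ\multimap\underline R$, $(\underline A\multimap\underline B)^\bullet=\underline B^\circ\multimap\underline A^\circ$; $\underline\alpha^\circ=\underline\alpha$ if $\underline\alpha\neq\underline R$, $=\underline I$ if $\underline R$ is the constant $\underline\alpha$; $\underline1^\circ=\underline0$; $(\underline A\&\underline B)^\circ=\underline A^\circ\oplus\underline B^\circ$; $(A\Rightarrow\underline B)^\circ=\,!(A^\bullet)\otimes\underline B^\circ$; $\underline I^\circ=\underline R$; $(!A)^\circ=A^\bullet\Rightarrow\underline R$; $(!A\otimes\underline B)^\circ=A^\bullet\Rightarrow\underline B^\circ$; $\underline0^\circ=\underline1$; $(\underline A\oplus\underline B)^\circ=\underline A^\circ\&\underline B^\circ$; $\Gamma^\bullet$ applies $(\cdot)^\bullet$ to each type. Value terms $\Gamma\mid-\vdash t:A$ go to $\Gamma^\bullet\mid-\vdash t^\bullet:A^\bullet$ and stoup terms $\Gamma\mid z{:}\underline D\vdash t:\underline B$ to $\Gamma^\bullet\mid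 k_z{:}\underline B^\circ\vdash t^\circ:\underline D^\circ$ ($k_z$ a designated fresh variable for $z$; $k,h,k_x,k_y$ fresh). Value clauses: $x^\bullet=x$; $*^\bullet=*$; $\langle t,u\rangle^\bullet=\langle t^\bullet,u^\bullet\rangle$; $(\pi_it)^\bullet=\pi_it^\bullet$; $(\lambda x{:}A.t)^\bullet=\lambda x{:}A^\bullet.t^\bullet$; $(t\,u)^\bullet=t^\bullet\,u^\bullet$; $\underline*^\bullet=\hat\lambda k{:}\underline0.\,\mathrm{abort}_{\underline R}(k)$; $\langle t,u\rangle_c^\bullet=\hat\lambda k{:}\underline A^\circ\oplus\underline B^\circ.\,\mathrm{case}\ k\ \mathrm{of}\ (\mathrm{inl}\,k_x\Rightarrow t^\bullet\{k_x\}\mid\mathrm{inr}\,k_y\Rightarrow u^\bullet\{k_y\})$; $(\underline\pi_1t)^\bullet=\hat\lambda k{:}\underline A^\circ.\,t^\bullet\{\mathrm{inl}\,k\}$; $(\underline\pi_2t)^\bullet=\hat\lambda k{:}\underline B^\circ.\,t^\bullet\{\mathrm{inr}\,k\}$; $(\underline\lambda x{:}A.t)^\bullet=\hat\lambda k{:}\,!A^\bullet\otimes\underline B^\circ.\,\mathrm{let}\ !x\otimes h\ \mathrm{be}\ k\ \mathrm{in}\ t^\bullet\{h\}$; $(s@t)^\bullet=\hat\lambda k{:}\underline B^\circ.\,s^\bullet\{!(t^\bullet)\otimes k\}$; $\top^\bullet=\hat\lambda k{:}\underline R.\,k$; $(\mathrm{let}\ \top\ \mathrm{be}\ t\ \mathrm{in}\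 u)^\bullet=\hat\lambda k{:}\underline A^\circ.\,t^\bullet\{u^\bullet\{k\}\}$; $(!t)^\bullet=\hat\lambda k{:}A^\bullet\Rightarrow\underline R.\,k@t^\bullet$; $(\mathrm{let}\ !x\ \mathrm{be}\ t\ \mathrm{in}\ u)^\bullet=\hat\lambda k{:}\underline B^\circ.\,t^\bullet\{\underline\lambda x{:}A^\bullet.\,u^\bullet\{k\}\}$; $(!t\otimes u)^\bullet=\hat\lambda k{:}A^\bullet\Rightarrow\underline B^\circ.\,u^\bullet\{k@t^\bullet\}$; $(\mathrm{let}\ !x\otimes y\ \mathrm{be}\ s\ \mathrm{in}\ t)^\bullet=\hat\lambda k{:}\underline C^\circ.\,s^\bullet\{\underline\lambda x{:}A^\bullet.\,t^\circ[k/k_y]\}$; $(\mathrm{abort}_{\underline A}(t))^\bullet=\hat\lambda k{:}\underline A^\circ.\,t^\bullet\{\underline*\}$; $(\mathrm{inl}\,t)^\bullet=\hat\lambda k{:}\underline A^\circ\&\underline B^\circ.\,t^\bullet\{\underline\pi_1k\}$; $(\mathrm{inr}\,t)^\bullet=\hat\lambda k{:}\underline A^\circ\&\underline B^\circ.\,t^\bullet\{\underline\pi_2k\}$; $(\mathrm{case}\ s\ \mathrm{of}\ (\mathrm{inl}\,x\Rightarrow t\mid\mathrm{inr}\,y\Rightarrow u))^\bullet=\hat\lambda k{:}\underline C^\circ.\,s^\bullet\{\langle t^\circ[k/k_x],u^\circ[k/k_y]\rangle_c\}$; $(\hat\lambda z{:}\underline A.t)^\bullet=\hat\lambda k{:}\underline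 B^\circ.\,t^\circ[k/k_z]$; $(s\{t\})^\bullet=\hat\lambda k{:}\underline B^\circ.\,t^\bullet\{s^\bullet\{k\}\}$. Stoup clauses: $z^\circ=k_z$; $\underline*^\circ=\mathrm{abort}_{\underline D^\circ}(k_z)$; $\langle t,u\rangle_c^\circ=\mathrm{case}\ k_z\ \mathrm{of}\ (\mathrm{inl}\,k_x\Rightarrow t^\circ[k_x/k_z]\mid\mathrm{inr}\,k_y\Rightarrow u^\circ[k_y/k_z])$; $(\underline\pi_1t)^\circ=t^\circ[\mathrm{inl}\,k_z/k_z]$; $(\underline\pi_2t)^\circ=t^\circ[\mathrm{inr}\,k_z/k_z]$; $(\underline\lambda x{:}A.t)^\circ=\mathrm{let}\ !x\otimes h\ \mathrm{be}\ k_z\ \mathrm{in}\ t^\circ[h/k_z]$; $(s@t)^\circ=s^\circ[(!(t^\bullet)\otimes k_z)/k_z]$; $(\mathrm{let}\ \top\ \mathrm{be}\ t\ \mathrm{in}\ u)^\circ=t^\circ[u^\bullet\{k_z\}/k_z]$; $(\mathrm{let}\ !x\ \mathrm{be}\ t\ \mathrm{in}\ u)^\circ=t^\circ[(\underline\lambda x{:}A^\bullet.\,u^\bullet\{k_z\})/k_z]$; $(!t\otimes u)^\circ=u^\circ[(k_z@t^\bullet)/k_z]$; $(\mathrm{let}\ !x\otimes y\ \mathrm{be}\ s\ \mathrm{in}\ t)^\circ=s^\circ[(\underline\lambda x{:}A^\bullet.\,t^\circ[k_z/k_y])/k_z]$; $(\mathrm{abort}(t))^\circ=t^\circ[\underline*/k_z]$;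 $(\mathrm{inl}\,t)^\circ=t^\circ[\underline\pi_1k_z/k_z]$; $(\mathrm{inr}\,t)^\circ=t^\circ[\underline\pi_2k_z/k_z]$; $(\mathrm{case}\ s\ \mathrm{of}\ (\mathrm{inl}\,x\Rightarrow t\mid\mathrm{inr}\,y\Rightarrow u))^\circ=s^\circ[\langle t^\circ[k_z/k_x],u^\circ[k_z/k_y]\rangle_c/k_z]$; $(s\{t\})^\circ=t^\circ[s^\bullet\{k_z\}/k_z]$. -}

module Defs where

open import Data.Nat using (ℕ; _≡ᵇ_)
open import Data.Bool using (Bool; true; false; if_then_else_)
open import Data.Maybe using (Maybe; just; nothing)
open import Relation.Binary.PropositionalEquality using (_≡_; refl)

data VTy : Set
data CTy : Set

data VTy where
  con  : ℕ → VTy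
  𝟙    : VTy
  _×̇_  : VTy → VTy → VTy
  _⇒_  : VTy → VTy → VTy
  ⌜_⌝  : CTy → VTy               -- every computation type is a value type
  _⊸_  : CTy → CTy → VTy

data CTy where
  ccon : ℕ → CTy
  𝟙c   : CTy
  _&_  : CTy → CTy → CTy
  _⇛_  : VTy → CTy → CTy
  I    : CTy
  !ᵀ   : VTy → CTy
  !_⊗_ : VTy → CTy → CTy         -- !A ⊗ B̲ (one primitive constructor)
  𝟘    : CTy
  _⊕_  : CTy → CTy → CTy

infixr 5 _⇒_ _⇛_
infixr 4 _⊸_

data Ctx : Set where
  ∅   : Ctx
  _,_ : Ctx → VTy → Ctx

data Var : Ctx → VTy → Set where
  zero : ∀ {Γ A} → Var (Γ , A) A
  suc  : ∀ {Γ A B} → Var Γ A → Var (Γ , B) A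

-- the stoup is empty (nothing) or holds one variable of computation type
Stoup : Set
Stoup = Maybe CTy

-- Intrinsically typed EEC terms:  Tm Γ Δ A  is  Γ | Δ ⊢ t : A.
-- The stoup variable is  svar.

data Tm (Γ : Ctx) : Stoup → VTy → Set where
  var   : ∀ {A} → Var Γ A → Tm Γ nothing A
  ⋆     : Tm Γ nothing 𝟙
  ⟨_,_⟩ : ∀ {A B} → Tm Γ nothing A → Tm Γ nothing B → Tm Γ nothing (A ×̇ B)
  π₁    : ∀ {A B} → Tm Γ nothing (A ×̇ B) → Tm Γ nothing A
  π₂    : ∀ {A B} → Tm Γ nothing (A ×̇ B) → Tm Γ nothing B
  ƛ     : ∀ {A B} → Tm (Γ , A) nothing B → Tm Γ nothing (A ⇒ B)
  _·_   : ∀ {A B} → Tm Γ nothing (A ⇒ B) → Tm Γ nothing A → Tm Γ nothing B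
  svar  : ∀ {C} → Tm Γ (just C) ⌜ C ⌝
  *c    : ∀ {Δ} → Tm Γ Δ ⌜ 𝟙c ⌝
  ⟨_,_⟩c : ∀ {Δ C D} → Tm Γ Δ ⌜ C ⌝ → Tm Γ Δ ⌜ D ⌝ → Tm Γ Δ ⌜ C & D ⌝
  fst   : ∀ {Δ C D} → Tm Γ Δ ⌜ C & D ⌝ → Tm Γ Δ ⌜ C ⌝
  snd   : ∀ {Δ C D} → Tm Γ Δ ⌜ C & D ⌝ → Tm Γ Δ ⌜ D ⌝
  λc    : ∀ {Δ A C} → Tm (Γ , A) Δ ⌜ C ⌝ → Tm Γ Δ ⌜ A ⇛ C ⌝
  _∙_   : ∀ {Δ A C} → Tm Γ Δ ⌜ A ⇛ C ⌝ → Tm Γ nothing A → Tm Γ Δ ⌜ C ⌝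
  ⊤     : Tm Γ nothing ⌜ I ⌝
  let⊤  : ∀ {Δ C} → Tm Γ Δ ⌜ I ⌝ → Tm Γ nothing ⌜ C ⌝ → Tm Γ Δ ⌜ C ⌝
  bang  : ∀ {A} → Tm Γ nothing A → Tm Γ nothing ⌜ !ᵀ A ⌝
  let!  : ∀ {Δ A C} → Tm Γ Δ ⌜ !ᵀ A ⌝ → Tm (Γ , A) nothing ⌜ C ⌝ → Tm Γ Δ ⌜ C ⌝
  bang⊗ : ∀ {Δ A C} → Tm Γ nothing A → Tm Γ Δ ⌜ C ⌝ → Tm Γ Δ ⌜ ! A ⊗ C ⌝
  let!⊗ : ∀ {Δ A C D} → Tm Γ Δ ⌜ ! A ⊗ C ⌝ → Tm (Γ , A) (just C) ⌜ D ⌝ → Tm Γ Δ ⌜ D ⌝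
  abort : ∀ {Δ C} → Tm Γ Δ ⌜ 𝟘 ⌝ → Tm Γ Δ ⌜ C ⌝
  inl   : ∀ {Δ C D} → Tm Γ Δ ⌜ C ⌝ → Tm Γ Δ ⌜ C ⊕ D ⌝
  inr   : ∀ {Δ C D} → Tm Γ Δ ⌜ D ⌝ → Tm Γ Δ ⌜ C ⊕ D ⌝
  case  : ∀ {Δ C D E} → Tm Γ Δ ⌜ C ⊕ D ⌝ → Tm Γ (just C) ⌜ E ⌝ → Tm Γ (just D) ⌜ E ⌝ → Tm Γ Δ ⌜ E ⌝
  λ̂     : ∀ {C D} → Tm Γ (just C) ⌜ D ⌝ → Tm Γ nothing (C ⊸ D)
  app   : ∀ {Δ C D} → Tm Γ nothing (C ⊸ D) → Tm Γ Δ ⌜ C ⌝ → Tm Γ Δ ⌜ D ⌝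

Ren : Ctx → Ctx → Set
Ren Γ Γ' = ∀ {A} → Var Γ A → Var Γ' A

ext : ∀ {Γ Γ' B} → Ren Γ Γ' → Ren (Γ , B) (Γ' , B)
ext ρ zero    = zero
ext ρ (suc x) = suc (ρ x)

ren : ∀ {Γ Γ' Δ A} → Ren Γ Γ' → Tm Γ Δ A → Tm Γ' Δ A
ren ρ (var x) = var (ρ x)
ren ρ ⋆ = ⋆
ren ρ ⟨ t , u ⟩ = ⟨ ren ρ t , ren ρ u ⟩
ren ρ (π₁ t) = π₁ (ren ρ t)
ren ρ (π₂ t) = π₂ (ren ρ t)
ren ρ (ƛ t) = ƛ (ren (ext ρ) t)
ren ρ (t · u) = ren ρ t · ren ρ u
ren ρ svar = svar
ren ρ *c = *c
ren ρ ⟨ t , u ⟩c = ⟨ ren ρ t , ren ρ u ⟩c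
ren ρ (fst t) = fst (ren ρ t)
ren ρ (snd t) = snd (ren ρ t)
ren ρ (λc t) = λc (ren (ext ρ) t)
ren ρ (s ∙ t) = ren ρ s ∙ ren ρ t
ren ρ ⊤ = ⊤
ren ρ (let⊤ t u) = let⊤ (ren ρ t) (ren ρ u)
ren ρ (bang t) = bang (ren ρ t)
ren ρ (let! t u) = let! (ren ρ t) (ren (ext ρ) u)
ren ρ (bang⊗ t u) = bang⊗ (ren ρ t) (ren ρ u)
ren ρ (let!⊗ s t) = let!⊗ (ren ρ s) (ren (ext ρ) t)
ren ρ (abort t) = abort (ren ρ t)
ren ρ (inl t) = inl (ren ρ t)
ren ρ (inr t) = inr (ren ρ t)
ren ρ (case s t u) = case (ren ρ s) (ren ρ t) (ren ρ u)
ren ρ (λ̂ t) = λ̂ (ren ρ t)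
ren ρ (app s t) = app (ren ρ s) (ren ρ t)

wk : ∀ {Γ Δ A B} → Tm Γ Δ A → Tm (Γ , B) Δ A
wk = ren suc

Sub : Ctx → Ctx → Set
Sub Γ Γ' = ∀ {A} → Var Γ A → Tm Γ' nothing A

exts : ∀ {Γ Γ' B} → Sub Γ Γ' → Sub (Γ , B) (Γ' , B)
exts σ zero    = var zero
exts σ (suc x) = wk (σ x)

sub : ∀ {Γ Γ' Δ A} → Sub Γ Γ' → Tm Γ Δ A → Tm Γ' Δ A
sub σ (var x) = σ x
sub σ ⋆ = ⋆
sub σ ⟨ t , u ⟩ = ⟨ sub σ t , sub σ u ⟩
sub σ (π₁ t) = π₁ (sub σ t)
sub σ (π₂ t) = π₂ (sub σ t)
sub σ (ƛ t) = ƛ (sub (exts σ) t)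
sub σ (t · u) = sub σ t · sub σ u
sub σ svar = svar
sub σ *c = *c
sub σ ⟨ t , u ⟩c = ⟨ sub σ t , sub σ u ⟩c
sub σ (fst t) = fst (sub σ t)
sub σ (snd t) = snd (sub σ t)
sub σ (λc t) = λc (sub (exts σ) t)
sub σ (s ∙ t) = sub σ s ∙ sub σ t
sub σ ⊤ = ⊤
sub σ (let⊤ t u) = let⊤ (sub σ t) (sub σ u)
sub σ (bang t) = bang (sub σ t)
sub σ (let! t u) = let! (sub σ t) (sub (exts σ) u)
sub σ (bang⊗ t u) = bang⊗ (sub σ t) (sub σ u)
sub σ (let!⊗ s t) = let!⊗ (sub σ s) (sub (exts σ) t)
sub σ (abort t) = abort (sub σ t)
sub σ (inl t) = inl (sub σ t)
sub σ (inr t) = inr (sub σ t)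
sub σ (case s t u) = case (sub σ s) (sub σ t) (sub σ u)
sub σ (λ̂ t) = λ̂ (sub σ t)
sub σ (app s t) = app (sub σ s) (sub σ t)

sub₀ : ∀ {Γ A} → Tm Γ nothing A → Sub (Γ , A) Γ
sub₀ u zero    = u
sub₀ u (suc x) = var x

_[_] : ∀ {Γ Δ A B} → Tm (Γ , A) Δ B → Tm Γ nothing A → Tm Γ Δ B
t [ u ] = sub (sub₀ u) t

ssub : ∀ {Γ Δ C A} → Tm Γ (just C) A → Tm Γ Δ ⌜ C ⌝ → Tm Γ Δ A
ssub svar u = u
ssub *c u = *c
ssub ⟨ t , t' ⟩c u = ⟨ ssub t u , ssub t' u ⟩c
ssub (fst t) u = fst (ssub t u)
ssub (snd t) u = snd (ssub t u)
ssub (λc t) u = λc (ssub t (wk u))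
ssub (s ∙ t) u = ssub s u ∙ t
ssub (let⊤ t t') u = let⊤ (ssub t u) t'
ssub (let! t t') u = let! (ssub t u) t'
ssub (bang⊗ t t') u = bang⊗ t (ssub t' u)
ssub (let!⊗ s t) u = let!⊗ (ssub s u) t
ssub (abort t) u = abort (ssub t u)
ssub (inl t) u = inl (ssub t u)
ssub (inr t) u = inr (ssub t u)
ssub (case s t t') u = case (ssub s u) t t'
ssub (app s t) u = app s (ssub t u)

infix 3 _≈_

data _≈_ : ∀ {Γ Δ A} → Tm Γ Δ A → Tm Γ Δ A → Set where
  ≈refl  : ∀ {Γ Δ A} {t : Tm Γ Δ A} → t ≈ t
  ≈sym   : ∀ {Γ Δ A} {t u : Tm Γ Δ A} → t ≈ u → u ≈ t
  ≈trans : ∀ {Γ Δ A} {t u v : Tm Γ Δ A} → t ≈ u → u ≈ v → t ≈ v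
  c⟨,⟩  : ∀ {Γ A B} {t t' : Tm Γ nothing A} {u u' : Tm Γ nothing B} → t ≈ t' → u ≈ u' → ⟨ t , u ⟩ ≈ ⟨ t' , u' ⟩
  cπ₁   : ∀ {Γ A B} {t t' : Tm Γ nothing (A ×̇ B)} → t ≈ t' → π₁ t ≈ π₁ t'
  cπ₂   : ∀ {Γ A B} {t t' : Tm Γ nothing (A ×̇ B)} → t ≈ t' → π₂ t ≈ π₂ t'
  cƛ    : ∀ {Γ A B} {t t' : Tm (Γ , A) nothing B} → t ≈ t' → ƛ t ≈ ƛ t'
  c·    : ∀ {Γ A B} {t t' : Tm Γ nothing (A ⇒ B)} {u u' : Tm Γ nothing A} → t ≈ t' → u ≈ u' → t · u ≈ t' · u'
  c⟨,⟩c : ∀ {Γ Δ C D} {t t' : Tm Γ Δ ⌜ C ⌝} {u u' : Tm Γ Δ ⌜ D ⌝} → t ≈ t' → u ≈ u' → ⟨ t , u ⟩c ≈ ⟨ t' , u' ⟩c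
  cfst  : ∀ {Γ Δ C D} {t t' : Tm Γ Δ ⌜ C & D ⌝} → t ≈ t' → fst t ≈ fst t'
  csnd  : ∀ {Γ Δ C D} {t t' : Tm Γ Δ ⌜ C & D ⌝} → t ≈ t' → snd t ≈ snd t'
  cλc   : ∀ {Γ Δ A C} {t t' : Tm (Γ , A) Δ ⌜ C ⌝} → t ≈ t' → λc t ≈ λc t'
  c∙    : ∀ {Γ Δ A C} {s s' : Tm Γ Δ ⌜ A ⇛ C ⌝} {t t' : Tm Γ nothing A} → s ≈ s' → t ≈ t' → s ∙ t ≈ s' ∙ t'
  clet⊤ : ∀ {Γ Δ C} {t t' : Tm Γ Δ ⌜ I ⌝} {u u' : Tm Γ nothing ⌜ C ⌝} → t ≈ t' → u ≈ u' → let⊤ t u ≈ let⊤ t' u'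
  cbang : ∀ {Γ A} {t t' : Tm Γ nothing A} → t ≈ t' → bang t ≈ bang t'
  clet! : ∀ {Γ Δ A C} {t t' : Tm Γ Δ ⌜ !ᵀ A ⌝} {u u' : Tm (Γ , A) nothing ⌜ C ⌝} → t ≈ t' → u ≈ u' → let! t u ≈ let! t' u'
  cbang⊗ : ∀ {Γ Δ A C} {t t' : Tm Γ nothing A} {u u' : Tm Γ Δ ⌜ C ⌝} → t ≈ t' → u ≈ u' → bang⊗ t u ≈ bang⊗ t' u'
  clet!⊗ : ∀ {Γ Δ A C D} {s s' : Tm Γ Δ ⌜ ! A ⊗ C ⌝} {t t' : Tm (Γ , A) (just C) ⌜ D ⌝} → s ≈ s' → t ≈ t' → let!⊗ s t ≈ let!⊗ s' t'
  cabort : ∀ {Γ Δ C} {t t' : Tm Γ Δ ⌜ 𝟘 ⌝} → t ≈ t' → abort {C = C} t ≈ abort t'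
  cinl  : ∀ {Γ Δ C D} {t t' : Tm Γ Δ ⌜ C ⌝} → t ≈ t' → inl {D = D} t ≈ inl t'
  cinr  : ∀ {Γ Δ C D} {t t' : Tm Γ Δ ⌜ D ⌝} → t ≈ t' → inr {C = C} t ≈ inr t'
  ccase : ∀ {Γ Δ C D E} {s s' : Tm Γ Δ ⌜ C ⊕ D ⌝} {t t' : Tm Γ (just C) ⌜ E ⌝} {u u' : Tm Γ (just D) ⌜ E ⌝} →
          s ≈ s' → t ≈ t' → u ≈ u' → case s t u ≈ case s' t' u'
  cλ̂    : ∀ {Γ C D} {t t' : Tm Γ (just C) ⌜ D ⌝} → t ≈ t' → λ̂ t ≈ λ̂ t'
  capp  : ∀ {Γ Δ C D} {s s' : Tm Γ nothing (C ⊸ D)} {t t' : Tm Γ Δ ⌜ C ⌝} → s ≈ s' → t ≈ t' → app s t ≈ app s' t'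
  η𝟙    : ∀ {Γ} (t : Tm Γ nothing 𝟙) → t ≈ ⋆
  β×₁   : ∀ {Γ A B} (t : Tm Γ nothing A) (u : Tm Γ nothing B) → π₁ ⟨ t , u ⟩ ≈ t
  β×₂   : ∀ {Γ A B} (t : Tm Γ nothing A) (u : Tm Γ nothing B) → π₂ ⟨ t , u ⟩ ≈ u
  η×    : ∀ {Γ A B} (t : Tm Γ nothing (A ×̇ B)) → ⟨ π₁ t , π₂ t ⟩ ≈ t
  β→    : ∀ {Γ A B} (t : Tm (Γ , A) nothing B) (u : Tm Γ nothing A) → ƛ t · u ≈ t [ u ]
  η→    : ∀ {Γ A B} (t : Tm Γ nothing (A ⇒ B)) → ƛ (wk t · var zero) ≈ t
  η𝟙c   : ∀ {Γ Δ} (t : Tm Γ Δ ⌜ 𝟙c ⌝) → t ≈ *c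
  β&₁   : ∀ {Γ Δ C D} (t : Tm Γ Δ ⌜ C ⌝) (u : Tm Γ Δ ⌜ D ⌝) → fst ⟨ t , u ⟩c ≈ t
  β&₂   : ∀ {Γ Δ C D} (t : Tm Γ Δ ⌜ C ⌝) (u : Tm Γ Δ ⌜ D ⌝) → snd ⟨ t , u ⟩c ≈ u
  η&    : ∀ {Γ Δ C D} (t : Tm Γ Δ ⌜ C & D ⌝) → ⟨ fst t , snd t ⟩c ≈ t
  β⇛    : ∀ {Γ Δ A C} (t : Tm (Γ , A) Δ ⌜ C ⌝) (u : Tm Γ nothing A) → λc t ∙ u ≈ t [ u ]
  η⇛    : ∀ {Γ Δ A C} (t : Tm Γ Δ ⌜ A ⇛ C ⌝) → λc (wk t ∙ var zero) ≈ t
  βI    : ∀ {Γ C} (t : Tm Γ nothing ⌜ C ⌝) → let⊤ ⊤ t ≈ t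
  ηI    : ∀ {Γ Δ C} (t : Tm Γ Δ ⌜ I ⌝) (u : Tm Γ (just I) ⌜ C ⌝) → let⊤ t (ssub u ⊤) ≈ ssub u t
  β!    : ∀ {Γ A C} (t : Tm Γ nothing A) (u : Tm (Γ , A) nothing ⌜ C ⌝) → let! (bang t) u ≈ u [ t ]
  η!    : ∀ {Γ Δ A C} (t : Tm Γ Δ ⌜ !ᵀ A ⌝) (u : Tm Γ (just (!ᵀ A)) ⌜ C ⌝) →
          let! t (ssub (wk u) (bang (var zero))) ≈ ssub u t
  β!⊗   : ∀ {Γ Δ A C D} (t : Tm Γ nothing A) (s : Tm Γ Δ ⌜ C ⌝) (u : Tm (Γ , A) (just C) ⌜ D ⌝) →
          let!⊗ (bang⊗ t s) u ≈ ssub (u [ t ]) s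
  η!⊗   : ∀ {Γ Δ A C D} (t : Tm Γ Δ ⌜ ! A ⊗ C ⌝) (u : Tm Γ (just (! A ⊗ C)) ⌜ D ⌝) →
          let!⊗ t (ssub (wk u) (bang⊗ (var zero) svar)) ≈ ssub u t
  η𝟘    : ∀ {Γ Δ C} (t : Tm Γ Δ ⌜ 𝟘 ⌝) (u : Tm Γ (just 𝟘) ⌜ C ⌝) → abort t ≈ ssub u t
  β⊕₁   : ∀ {Γ Δ C D E} (t : Tm Γ Δ ⌜ C ⌝) (u : Tm Γ (just C) ⌜ E ⌝) (u' : Tm Γ (just D) ⌜ E ⌝) →
          case (inl t) u u' ≈ ssub u t
  β⊕₂   : ∀ {Γ Δ C D E} (t : Tm Γ Δ ⌜ D ⌝) (u : Tm Γ (just C) ⌜ E ⌝) (u' : Tm Γ (just D) ⌜ E ⌝) →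
          case (inr t) u u' ≈ ssub u' t
  η⊕    : ∀ {Γ Δ C D E} (t : Tm Γ Δ ⌜ C ⊕ D ⌝) (u : Tm Γ (just (C ⊕ D)) ⌜ E ⌝) →
          case t (ssub u (inl svar)) (ssub u (inr svar)) ≈ ssub u t
  β⊸    : ∀ {Γ Δ C D} (t : Tm Γ (just C) ⌜ D ⌝) (u : Tm Γ Δ ⌜ C ⌝) → app (λ̂ t) u ≈ ssub t u
  η⊸    : ∀ {Γ C D} (t : Tm Γ nothing (C ⊸ D)) → λ̂ (app t svar) ≈ t

-- Simply-typed λ-calculus (type constants ℕ-indexed, shared with the
-- EEC value-type constants  con n).

data STy : Set where
  base : ℕ → STy
  𝟙ˢ   : STy
  _×ˢ_ : STy → STy → STy
  _→ˢ_ : STy → STy → STy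

data SCtx : Set where
  ∅ : SCtx
  _,_ : SCtx → STy → SCtx

data SVar : SCtx → STy → Set where
  zero : ∀ {Θ σ} → SVar (Θ , σ) σ
  suc  : ∀ {Θ σ τ} → SVar Θ σ → SVar (Θ , τ) σ

data Λ (Θ : SCtx) : STy → Set where
  var   : ∀ {σ} → SVar Θ σ → Λ Θ σ
  ⋆     : Λ Θ 𝟙ˢ
  ⟨_,_⟩ : ∀ {σ τ} → Λ Θ σ → Λ Θ τ → Λ Θ (σ ×ˢ τ)
  π₁    : ∀ {σ τ} → Λ Θ (σ ×ˢ τ) → Λ Θ σ
  π₂    : ∀ {σ τ} → Λ Θ (σ ×ˢ τ) → Λ Θ τ
  ƛ     : ∀ {σ τ} → Λ (Θ , σ) τ → Λ Θ (σ →ˢ τ)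
  _·_   : ∀ {σ τ} → Λ Θ (σ →ˢ τ) → Λ Θ σ → Λ Θ τ

tyV : STy → VTy
tyV (base n) = con n
tyV 𝟙ˢ = 𝟙
tyV (σ ×ˢ τ) = tyV σ ×̇ tyV τ
tyV (σ →ˢ τ) = tyV σ ⇒ ⌜ !ᵀ (tyV τ) ⌝

ctxV : SCtx → Ctx
ctxV ∅ = ∅
ctxV (Θ , σ) = ctxV Θ , tyV σ

varV : ∀ {Θ σ} → SVar Θ σ → Var (ctxV Θ) (tyV σ)
varV zero = zero
varV (suc x) = suc (varV x)

tmV : ∀ {Θ σ} → Λ Θ σ → Tm (ctxV Θ) nothing ⌜ !ᵀ (tyV σ) ⌝
tmV (var x) = bang (var (varV x))
tmV ⋆ = bang ⋆
tmV ⟨ M , N ⟩ = let! (tmV M) (let! (wk (tmV N)) (bang ⟨ var (suc zero) , var zero ⟩))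
tmV (π₁ M) = let! (tmV M) (bang (π₁ (var zero)))
tmV (π₂ M) = let! (tmV M) (bang (π₂ (var zero)))
tmV (ƛ M) = bang (ƛ (tmV M))
tmV (M · N) = let! (tmV M) (let! (wk (tmV N)) (var (suc zero) · var zero))

isConst : CTy → ℕ → Bool
isConst (ccon m) n = m ≡ᵇ n
isConst _ n = false

module _ (R : CTy) where

  tyLV : STy → VTy
  tyLV (base n) = con n
  tyLV 𝟙ˢ = 𝟙
  tyLV (σ ×ˢ τ) = tyLV σ ×̇ tyLV τ
  tyLV (σ →ˢ τ) = tyLV σ ⇒ ((tyLV τ ⇛ R) ⊸ R)

  ctxLV : SCtx → Ctx
  ctxLV ∅ = ∅
  ctxLV (Θ , σ) = ctxLV Θ , tyLV σ

  varLV : ∀ {Θ σ} → SVar Θ σ → Var (ctxLV Θ) (tyLV σ)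
  varLV zero = zero
  varLV (suc x) = suc (varLV x)

  tmLV : ∀ {Θ σ} → Λ Θ σ → Tm (ctxLV Θ) nothing ((tyLV σ ⇛ R) ⊸ R)
  tmLV (var x) = λ̂ (svar ∙ var (varLV x))
  tmLV ⋆ = λ̂ (svar ∙ ⋆)
  tmLV ⟨ M , N ⟩ = λ̂ (app (tmLV M) (λc (app (wk (tmLV N)) (λc (svar ∙ ⟨ var (suc zero) , var zero ⟩)))))
  tmLV (π₁ M) = λ̂ (app (tmLV M) (λc (svar ∙ π₁ (var zero))))
  tmLV (π₂ M) = λ̂ (app (tmLV M) (λc (svar ∙ π₂ (var zero))))
  tmLV (ƛ M) = λ̂ (svar ∙ ƛ (tmLV M))
  tmLV (M · N) = λ̂ (app (tmLV M) (λc (app (wk (tmLV N)) (λc (app (var (suc zero) · var zero) svar)))))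

  -- generic self-translation of EEC:  (·)^• on value types, (·)^° on computation types
  tyB : VTy → VTy
  tyC : CTy → CTy
  tyB (con n) = con n
  tyB 𝟙 = 𝟙
  tyB (A ×̇ B) = tyB A ×̇ tyB B
  tyB (A ⇒ B) = tyB A ⇒ tyB B
  tyB ⌜ C ⌝ = tyC C ⊸ R
  tyB (C ⊸ D) = tyC D ⊸ tyC C
  tyC (ccon n) = if isConst R n then I else ccon n
  tyC 𝟙c = 𝟘
  tyC (C & D) = tyC C ⊕ tyC D
  tyC (A ⇛ C) = ! tyB A ⊗ tyC C
  tyC I = R
  tyC (!ᵀ A) = tyB A ⇛ R
  tyC (! A ⊗ C) = tyB A ⇛ tyC C
  tyC 𝟘 = 𝟙c
  tyC (C ⊕ D) = tyC C & tyC D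

  ctxB : Ctx → Ctx
  ctxB ∅ = ∅
  ctxB (Γ , A) = ctxB Γ , tyB A

  varB : ∀ {Γ A} → Var Γ A → Var (ctxB Γ) (tyB A)
  varB zero = zero
  varB (suc x) = suc (varB x)

  tmB : ∀ {Γ A} → Tm Γ nothing A → Tm (ctxB Γ) nothing (tyB A)
  tmC : ∀ {Γ D B} → Tm Γ (just D) ⌜ B ⌝ → Tm (ctxB Γ) (just (tyC B)) ⌜ tyC D ⌝

  tmB (var x) = var (varB x)
  tmB ⋆ = ⋆
  tmB ⟨ t , u ⟩ = ⟨ tmB t , tmB u ⟩
  tmB (π₁ t) = π₁ (tmB t)
  tmB (π₂ t) = π₂ (tmB t)
  tmB (ƛ t) = ƛ (tmB t)
  tmB (t · u) = tmB t · tmB u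
  tmB *c = λ̂ (abort svar)
  tmB ⟨ t , u ⟩c = λ̂ (case svar (app (tmB t) svar) (app (tmB u) svar))
  tmB (fst t) = λ̂ (app (tmB t) (inl svar))
  tmB (snd t) = λ̂ (app (tmB t) (inr svar))
  tmB (λc t) = λ̂ (let!⊗ svar (app (tmB t) svar))
  tmB (s ∙ t) = λ̂ (app (tmB s) (bang⊗ (tmB t) svar))
  tmB ⊤ = λ̂ svar
  tmB (let⊤ t u) = λ̂ (app (tmB t) (app (tmB u) svar))
  tmB (bang t) = λ̂ (svar ∙ tmB t)
  tmB (let! t u) = λ̂ (app (tmB t) (λc (app (tmB u) svar)))
  tmB (bang⊗ t u) = λ̂ (app (tmB u) (svar ∙ tmB t))
  tmB (let!⊗ s t) = λ̂ (app (tmB s) (λc (tmC t)))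
  tmB (abort t) = λ̂ (app (tmB t) *c)
  tmB (inl t) = λ̂ (app (tmB t) (fst svar))
  tmB (inr t) = λ̂ (app (tmB t) (snd svar))
  tmB (case s t u) = λ̂ (app (tmB s) ⟨ tmC t , tmC u ⟩c)
  tmB (λ̂ t) = λ̂ (tmC t)
  tmB (app s t) = λ̂ (app (tmB t) (app (tmB s) svar))

  tmC svar = svar
  tmC *c = abort svar
  tmC ⟨ t , u ⟩c = case svar (tmC t) (tmC u)
  tmC (fst t) = ssub (tmC t) (inl svar)
  tmC (snd t) = ssub (tmC t) (inr svar)
  tmC (λc t) = let!⊗ svar (tmC t)
  tmC (s ∙ t) = ssub (tmC s) (bang⊗ (tmB t) svar)
  tmC (let⊤ t u) = ssub (tmC t) (app (tmB u) svar)
  tmC (let! t u) = ssub (tmC t) (λc (app (tmB u) svar))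
  tmC (bang⊗ t u) = ssub (tmC u) (svar ∙ tmB t)
  tmC (let!⊗ s t) = ssub (tmC s) (λc (tmC t))
  tmC (abort t) = ssub (tmC t) *c
  tmC (inl t) = ssub (tmC t) (fst svar)
  tmC (inr t) = ssub (tmC t) (snd svar)
  tmC (case s t u) = ssub (tmC s) ⟨ tmC t , tmC u ⟩c
  tmC (app s t) = ssub (tmC t) (app (tmB s) svar)

cast : ∀ {Γ Γ' Δ A A'} → Γ ≡ Γ' → A ≡ A' → Tm Γ Δ A → Tm Γ' Δ A'
cast refl refl t = t

module Submission where

-- The type part is a direct induction on simple types: σ^lv and (σ^v)^•
-- unfold to the same constructors.  The term part splits into two facts.
--
-- Let  cps M  be the lv-translation of M
--    written clause by clause, but typed at  (σ^v)^•  instead of  σ^lv.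
--    (M^v)^•  differs from  cps M  only by administrative redexes
--    (λ̂k. t){k} of the self-translation, removed by β⊸; so  cps M ≈ (M^v)^•.
--    Since pairing and application weaken a subterm, this is proved under an
--    arbitrary renaming, using that the self-translation commutes with renaming.
--  * Transport.  M^lv and  cps M  are the same term up to the propositional
--    identity of their types, i.e. heterogeneously equal; so M^lv is the
--    transport of  cps M , and transport respects ≈.

open import Data.Maybe using (just; nothing)
open import Data.Product using (_×_; _,_)
open import Relation.Binary.PropositionalEquality
  using (_≡_; refl; sym; trans; cong; cong₂)
open import Relation.Binary.HeterogeneousEquality as H using (_≅_)
open import Defs

≡⇒≈ : ∀ {Γ Δ A} {t u : Tm Γ Δ A} → t ≡ u → t ≈ u
≡⇒≈ refl = ≈refl

case-≡ : ∀ {Γ Δ C D E} {s s' : Tm Γ Δ ⌜ C ⊕ D ⌝} {t t' : Tm Γ (just C) ⌜ E ⌝}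
           {u u' : Tm Γ (just D) ⌜ E ⌝} →
         s ≡ s' → t ≡ t' → u ≡ u' → case s t u ≡ case s' t' u'
case-≡ refl refl refl = refl

ext-comp : ∀ {Γ Γ' Γ'' B} {ρ : Ren Γ' Γ''} {ρ' : Ren Γ Γ'} {ρ'' : Ren Γ Γ''} →
           (∀ {A} (x : Var Γ A) → ρ (ρ' x) ≡ ρ'' x) →
           ∀ {A} (x : Var (Γ , B) A) → ext ρ (ext ρ' x) ≡ ext ρ'' x
ext-comp e zero    = refl
ext-comp e (suc x) = cong suc (e x)

ren-comp : ∀ {Γ Γ' Γ'' Δ A} {ρ : Ren Γ' Γ''} {ρ' : Ren Γ Γ'} {ρ'' : Ren Γ Γ''} →
           (∀ {B} (x : Var Γ B) → ρ (ρ' x) ≡ ρ'' x) →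
           (t : Tm Γ Δ A) → ren ρ (ren ρ' t) ≡ ren ρ'' t
ren-comp e (var x)      = cong var (e x)
ren-comp e ⋆            = refl
ren-comp e ⟨ t , u ⟩    = cong₂ ⟨_,_⟩ (ren-comp e t) (ren-comp e u)
ren-comp e (π₁ t)       = cong π₁ (ren-comp e t)
ren-comp e (π₂ t)       = cong π₂ (ren-comp e t)
ren-comp e (ƛ t)        = cong ƛ (ren-comp (ext-comp e) t)
ren-comp e (t · u)      = cong₂ _·_ (ren-comp e t) (ren-comp e u)
ren-comp e svar         = refl
ren-comp e *c           = refl
ren-comp e ⟨ t , u ⟩c   = cong₂ ⟨_,_⟩c (ren-comp e t) (ren-comp e u)
ren-comp e (fst t)      = cong fst (ren-comp e t)
ren-comp e (snd t)      = cong snd (ren-comp e t)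
ren-comp e (λc t)       = cong λc (ren-comp (ext-comp e) t)
ren-comp e (s ∙ t)      = cong₂ _∙_ (ren-comp e s) (ren-comp e t)
ren-comp e ⊤            = refl
ren-comp e (let⊤ t u)   = cong₂ let⊤ (ren-comp e t) (ren-comp e u)
ren-comp e (bang t)     = cong bang (ren-comp e t)
ren-comp e (let! t u)   = cong₂ let! (ren-comp e t) (ren-comp (ext-comp e) u)
ren-comp e (bang⊗ t u)  = cong₂ bang⊗ (ren-comp e t) (ren-comp e u)
ren-comp e (let!⊗ s t)  = cong₂ let!⊗ (ren-comp e s) (ren-comp (ext-comp e) t)
ren-comp e (abort t)    = cong abort (ren-comp e t)
ren-comp e (inl t)      = cong inl (ren-comp e t)
ren-comp e (inr t)      = cong inr (ren-comp e t)
ren-comp e (case s t u) = case-≡ (ren-comp e s) (ren-comp e t) (ren-comp e u)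
ren-comp e (λ̂ t)        = cong λ̂ (ren-comp e t)
ren-comp e (app s t)    = cong₂ app (ren-comp e s) (ren-comp e t)

ext-id : ∀ {Γ B} {ρ : Ren Γ Γ} → (∀ {A} (x : Var Γ A) → ρ x ≡ x) →
         ∀ {A} (x : Var (Γ , B) A) → ext ρ x ≡ x
ext-id e zero    = refl
ext-id e (suc x) = cong suc (e x)

ren-id : ∀ {Γ Δ A} {ρ : Ren Γ Γ} → (∀ {B} (x : Var Γ B) → ρ x ≡ x) →
         (t : Tm Γ Δ A) → ren ρ t ≡ t
ren-id e (var x)      = cong var (e x)
ren-id e ⋆            = refl
ren-id e ⟨ t , u ⟩    = cong₂ ⟨_,_⟩ (ren-id e t) (ren-id e u)
ren-id e (π₁ t)       = cong π₁ (ren-id e t)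
ren-id e (π₂ t)       = cong π₂ (ren-id e t)
ren-id e (ƛ t)        = cong ƛ (ren-id (ext-id e) t)
ren-id e (t · u)      = cong₂ _·_ (ren-id e t) (ren-id e u)
ren-id e svar         = refl
ren-id e *c           = refl
ren-id e ⟨ t , u ⟩c   = cong₂ ⟨_,_⟩c (ren-id e t) (ren-id e u)
ren-id e (fst t)      = cong fst (ren-id e t)
ren-id e (snd t)      = cong snd (ren-id e t)
ren-id e (λc t)       = cong λc (ren-id (ext-id e) t)
ren-id e (s ∙ t)      = cong₂ _∙_ (ren-id e s) (ren-id e t)
ren-id e ⊤            = refl
ren-id e (let⊤ t u)   = cong₂ let⊤ (ren-id e t) (ren-id e u)
ren-id e (bang t)     = cong bang (ren-id e t)
ren-id e (let! t u)   = cong₂ let! (ren-id e t) (ren-id (ext-id e) u)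
ren-id e (bang⊗ t u)  = cong₂ bang⊗ (ren-id e t) (ren-id e u)
ren-id e (let!⊗ s t)  = cong₂ let!⊗ (ren-id e s) (ren-id (ext-id e) t)
ren-id e (abort t)    = cong abort (ren-id e t)
ren-id e (inl t)      = cong inl (ren-id e t)
ren-id e (inr t)      = cong inr (ren-id e t)
ren-id e (case s t u) = case-≡ (ren-id e s) (ren-id e t) (ren-id e u)
ren-id e (λ̂ t)        = cong λ̂ (ren-id e t)
ren-id e (app s t)    = cong₂ app (ren-id e s) (ren-id e t)

ren-ext-wk : ∀ {Γ Γ' Δ A B} (ρ : Ren Γ Γ') (u : Tm Γ Δ A) →
             ren (ext {B = B} ρ) (wk u) ≡ wk (ren ρ u)
ren-ext-wk ρ u = trans (ren-comp (λ x → refl) u) (sym (ren-comp (λ x → refl) u))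

ren-ssub : ∀ {Γ Γ' Δ C A} (ρ : Ren Γ Γ') (t : Tm Γ (just C) A) (u : Tm Γ Δ ⌜ C ⌝) →
           ren ρ (ssub t u) ≡ ssub (ren ρ t) (ren ρ u)
ren-ssub ρ svar u          = refl
ren-ssub ρ *c u            = refl
ren-ssub ρ ⟨ t , t' ⟩c u   = cong₂ ⟨_,_⟩c (ren-ssub ρ t u) (ren-ssub ρ t' u)
ren-ssub ρ (fst t) u       = cong fst (ren-ssub ρ t u)
ren-ssub ρ (snd t) u       = cong snd (ren-ssub ρ t u)
ren-ssub ρ (λc t) u        = cong λc (trans (ren-ssub (ext ρ) t (wk u))
                                            (cong (ssub (ren (ext ρ) t)) (ren-ext-wk ρ u)))
ren-ssub ρ (s ∙ t) u       = cong (_∙ ren ρ t) (ren-ssub ρ s u)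
ren-ssub ρ (let⊤ t t') u   = cong (λ v → let⊤ v (ren ρ t')) (ren-ssub ρ t u)
ren-ssub ρ (let! t t') u   = cong (λ v → let! v (ren (ext ρ) t')) (ren-ssub ρ t u)
ren-ssub ρ (bang⊗ t t') u  = cong (bang⊗ (ren ρ t)) (ren-ssub ρ t' u)
ren-ssub ρ (let!⊗ s t) u   = cong (λ v → let!⊗ v (ren (ext ρ) t)) (ren-ssub ρ s u)
ren-ssub ρ (abort t) u     = cong abort (ren-ssub ρ t u)
ren-ssub ρ (inl t) u       = cong inl (ren-ssub ρ t u)
ren-ssub ρ (inr t) u       = cong inr (ren-ssub ρ t u)
ren-ssub ρ (case s t t') u = cong (λ v → case v (ren ρ t) (ren ρ t')) (ren-ssub ρ s u)
ren-ssub ρ (app s t) u     = cong (app (ren ρ s)) (ren-ssub ρ t u)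

ssub-svar : ∀ {Γ C A} (t : Tm Γ (just C) A) → ssub t svar ≡ t
ssub-svar svar          = refl
ssub-svar *c            = refl
ssub-svar ⟨ t , t' ⟩c   = cong₂ ⟨_,_⟩c (ssub-svar t) (ssub-svar t')
ssub-svar (fst t)       = cong fst (ssub-svar t)
ssub-svar (snd t)       = cong snd (ssub-svar t)
ssub-svar (λc t)        = cong λc (ssub-svar t)
ssub-svar (s ∙ t)       = cong (_∙ t) (ssub-svar s)
ssub-svar (let⊤ t t')   = cong (λ v → let⊤ v t') (ssub-svar t)
ssub-svar (let! t t')   = cong (λ v → let! v t') (ssub-svar t)
ssub-svar (bang⊗ t t')  = cong (bang⊗ t) (ssub-svar t')
ssub-svar (let!⊗ s t)   = cong (λ v → let!⊗ v t) (ssub-svar s)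
ssub-svar (abort t)     = cong abort (ssub-svar t)
ssub-svar (inl t)       = cong inl (ssub-svar t)
ssub-svar (inr t)       = cong inr (ssub-svar t)
ssub-svar (case s t t') = cong (λ v → case v t t') (ssub-svar s)
ssub-svar (app s t)     = cong (app s) (ssub-svar t)

administrative-β : ∀ {Γ C D} (t : Tm Γ (just C) ⌜ D ⌝) → app (λ̂ t) svar ≈ t
administrative-β t = ≈trans (β⊸ t svar) (≡⇒≈ (ssub-svar t))

-- Heterogeneous congruences: term formers (and de Bruijn variables) respect
-- heterogeneous equality once their type indices are identified.  They let
-- us compare two terms whose types are only propositionally equal.
≅-zero : ∀ {Γ Γ' A A'} → Γ ≡ Γ' → A ≡ A' → Var.zero {Γ} {A} ≅ Var.zero {Γ'} {A'}
≅-zero refl refl = H.refl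

≅-suc : ∀ {Γ Γ' A A' B B'} {x : Var Γ A} {x' : Var Γ' A'} →
        Γ ≡ Γ' → A ≡ A' → B ≡ B' → x ≅ x' → Var.suc {B = B} x ≅ Var.suc {B = B'} x'
≅-suc refl refl refl H.refl = H.refl

≅-var : ∀ {Γ Γ' A A'} {x : Var Γ A} {x' : Var Γ' A'} →
        Γ ≡ Γ' → A ≡ A' → x ≅ x' → Tm.var x ≅ Tm.var x'
≅-var refl refl H.refl = H.refl

≅-⋆ : ∀ {Γ Γ'} → Γ ≡ Γ' → Tm.⋆ {Γ} ≅ Tm.⋆ {Γ'}
≅-⋆ refl = H.refl

≅-pair : ∀ {Γ Γ' A A' B B'} {t : Tm Γ nothing A} {t' : Tm Γ' nothing A'}
           {u : Tm Γ nothing B} {u' : Tm Γ' nothing B'} →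
         Γ ≡ Γ' → A ≡ A' → B ≡ B' → t ≅ t' → u ≅ u' → Tm.⟨_,_⟩ t u ≅ Tm.⟨_,_⟩ t' u'
≅-pair refl refl refl H.refl H.refl = H.refl

≅-π₁ : ∀ {Γ Γ' A A' B B'} {t : Tm Γ nothing (A ×̇ B)} {t' : Tm Γ' nothing (A' ×̇ B')} →
       Γ ≡ Γ' → A ≡ A' → B ≡ B' → t ≅ t' → Tm.π₁ t ≅ Tm.π₁ t'
≅-π₁ refl refl refl H.refl = H.refl

≅-π₂ : ∀ {Γ Γ' A A' B B'} {t : Tm Γ nothing (A ×̇ B)} {t' : Tm Γ' nothing (A' ×̇ B')} →
       Γ ≡ Γ' → A ≡ A' → B ≡ B' → t ≅ t' → Tm.π₂ t ≅ Tm.π₂ t'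
≅-π₂ refl refl refl H.refl = H.refl

≅-ƛ : ∀ {Γ Γ' A A' B B'} {t : Tm (Γ , A) nothing B} {t' : Tm (Γ' , A') nothing B'} →
      Γ ≡ Γ' → A ≡ A' → B ≡ B' → t ≅ t' → Tm.ƛ t ≅ Tm.ƛ t'
≅-ƛ refl refl refl H.refl = H.refl

≅-· : ∀ {Γ Γ' A A' B B'} {t : Tm Γ nothing (A ⇒ B)} {t' : Tm Γ' nothing (A' ⇒ B')}
        {u : Tm Γ nothing A} {u' : Tm Γ' nothing A'} →
      Γ ≡ Γ' → A ≡ A' → B ≡ B' → t ≅ t' → u ≅ u' → t · u ≅ t' · u'
≅-· refl refl refl H.refl H.refl = H.refl

≅-svar : ∀ {Γ Γ' C C'} → Γ ≡ Γ' → C ≡ C' → Tm.svar {Γ} {C} ≅ Tm.svar {Γ'} {C'}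
≅-svar refl refl = H.refl

≅-λc : ∀ {Γ Γ' Δ Δ' A A' C C'} {t : Tm (Γ , A) Δ ⌜ C ⌝} {t' : Tm (Γ' , A') Δ' ⌜ C' ⌝} →
       Γ ≡ Γ' → Δ ≡ Δ' → A ≡ A' → C ≡ C' → t ≅ t' → Tm.λc t ≅ Tm.λc t'
≅-λc refl refl refl refl H.refl = H.refl

≅-∙ : ∀ {Γ Γ' Δ Δ' A A' C C'} {s : Tm Γ Δ ⌜ A ⇛ C ⌝} {s' : Tm Γ' Δ' ⌜ A' ⇛ C' ⌝}
        {t : Tm Γ nothing A} {t' : Tm Γ' nothing A'} →
      Γ ≡ Γ' → Δ ≡ Δ' → A ≡ A' → C ≡ C' → s ≅ s' → t ≅ t' → s ∙ t ≅ s' ∙ t'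
≅-∙ refl refl refl refl H.refl H.refl = H.refl

≅-λ̂ : ∀ {Γ Γ' C C' D D'} {t : Tm Γ (just C) ⌜ D ⌝} {t' : Tm Γ' (just C') ⌜ D' ⌝} →
      Γ ≡ Γ' → C ≡ C' → D ≡ D' → t ≅ t' → Tm.λ̂ t ≅ Tm.λ̂ t'
≅-λ̂ refl refl refl H.refl = H.refl

≅-app : ∀ {Γ Γ' Δ Δ' C C' D D'} {s : Tm Γ nothing (C ⊸ D)} {s' : Tm Γ' nothing (C' ⊸ D')}
          {t : Tm Γ Δ ⌜ C ⌝} {t' : Tm Γ' Δ' ⌜ C' ⌝} →
        Γ ≡ Γ' → Δ ≡ Δ' → C ≡ C' → D ≡ D' → s ≅ s' → t ≅ t' → app s t ≅ app s' t'
≅-app refl refl refl refl H.refl H.refl = H.refl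

≅-wk : ∀ {Γ Γ' Δ A A' B B'} {t : Tm Γ Δ A} {t' : Tm Γ' Δ A'} →
       Γ ≡ Γ' → A ≡ A' → B ≡ B' → t ≅ t' → wk {B = B} t ≅ wk {B = B'} t'
≅-wk refl refl refl H.refl = H.refl

≅⇒≡cast : ∀ {Γ Γ' Δ A A'} {t : Tm Γ Δ A} {t' : Tm Γ' Δ A'} →
          t ≅ t' → (p : Γ' ≡ Γ) (q : A' ≡ A) → t ≡ cast p q t'
≅⇒≡cast H.refl refl refl = refl

cast-≈ : ∀ {Γ Γ' Δ A A'} {t u : Tm Γ Δ A} (p : Γ ≡ Γ') (q : A ≡ A') →
         t ≈ u → cast p q t ≈ cast p q u
cast-≈ refl refl e = e

module _ (R : CTy) where

  Lifts : ∀ {Γ Γ'} → Ren (ctxB R Γ) (ctxB R Γ') → Ren Γ Γ' → Set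
  Lifts {Γ} ρ' ρ = ∀ {A} (x : Var Γ A) → ρ' (varB R x) ≡ varB R (ρ x)

  lifts-ext : ∀ {Γ Γ' B} {ρ : Ren Γ Γ'} {ρ' : Ren (ctxB R Γ) (ctxB R Γ')} →
              Lifts ρ' ρ → Lifts (ext ρ') (ext {B = B} ρ)
  lifts-ext h zero    = refl
  lifts-ext h (suc x) = cong suc (h x)

  tmB-ren : ∀ {Γ Γ' A} {ρ : Ren Γ Γ'} {ρ' : Ren (ctxB R Γ) (ctxB R Γ')} → Lifts ρ' ρ →
            (t : Tm Γ nothing A) → tmB R (ren ρ t) ≡ ren ρ' (tmB R t)
  tmC-ren : ∀ {Γ Γ' D B} {ρ : Ren Γ Γ'} {ρ' : Ren (ctxB R Γ) (ctxB R Γ')} → Lifts ρ' ρ →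
            (t : Tm Γ (just D) ⌜ B ⌝) → tmC R (ren ρ t) ≡ ren ρ' (tmC R t)
  tmB-ren h (var x)      = cong var (sym (h x))
  tmB-ren h ⋆            = refl
  tmB-ren h ⟨ t , u ⟩    = cong₂ ⟨_,_⟩ (tmB-ren h t) (tmB-ren h u)
  tmB-ren h (π₁ t)       = cong π₁ (tmB-ren h t)
  tmB-ren h (π₂ t)       = cong π₂ (tmB-ren h t)
  tmB-ren h (ƛ t)        = cong ƛ (tmB-ren (lifts-ext h) t)
  tmB-ren h (t · u)      = cong₂ _·_ (tmB-ren h t) (tmB-ren h u)
  tmB-ren h *c           = refl
  tmB-ren h ⟨ t , u ⟩c   rewrite tmB-ren h t | tmB-ren h u = refl
  tmB-ren h (fst t)      rewrite tmB-ren h t = refl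
  tmB-ren h (snd t)      rewrite tmB-ren h t = refl
  tmB-ren h (λc t)       rewrite tmB-ren (lifts-ext h) t = refl
  tmB-ren h (s ∙ t)      rewrite tmB-ren h s | tmB-ren h t = refl
  tmB-ren h ⊤            = refl
  tmB-ren h (let⊤ t u)   rewrite tmB-ren h t | tmB-ren h u = refl
  tmB-ren h (bang t)     rewrite tmB-ren h t = refl
  tmB-ren h (let! t u)   rewrite tmB-ren h t | tmB-ren (lifts-ext h) u = refl
  tmB-ren h (bang⊗ t u)  rewrite tmB-ren h t | tmB-ren h u = refl
  tmB-ren h (let!⊗ s t)  rewrite tmB-ren h s | tmC-ren (lifts-ext h) t = refl
  tmB-ren h (abort t)    rewrite tmB-ren h t = refl
  tmB-ren h (inl t)      rewrite tmB-ren h t = refl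
  tmB-ren h (inr t)      rewrite tmB-ren h t = refl
  tmB-ren h (case s t u) rewrite tmB-ren h s | tmC-ren h t | tmC-ren h u = refl
  tmB-ren h (λ̂ t)        rewrite tmC-ren h t = refl
  tmB-ren h (app s t)    rewrite tmB-ren h s | tmB-ren h t = refl
  -- Apart from  svar , *c , ⟨,⟩c  and  λc , every clause of (·)^° is a stoup
  -- substitution  ssub (t^°) k , which ren-ssub moves the renaming through.
  tmC-ren h svar                   = refl
  tmC-ren h *c                     = refl
  tmC-ren h ⟨ t , u ⟩c             rewrite tmC-ren h t | tmC-ren h u = refl
  tmC-ren h (λc t)                 rewrite tmC-ren (lifts-ext h) t = refl
  tmC-ren {ρ' = ρ'} h (fst t)      rewrite tmC-ren h t = sym (ren-ssub ρ' (tmC R t) _)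
  tmC-ren {ρ' = ρ'} h (snd t)      rewrite tmC-ren h t = sym (ren-ssub ρ' (tmC R t) _)
  tmC-ren {ρ' = ρ'} h (s ∙ t)      rewrite tmC-ren h s | tmB-ren h t = sym (ren-ssub ρ' (tmC R s) _)
  tmC-ren {ρ' = ρ'} h (let⊤ t u)   rewrite tmC-ren h t | tmB-ren h u = sym (ren-ssub ρ' (tmC R t) _)
  tmC-ren {ρ' = ρ'} h (let! t u)   rewrite tmC-ren h t | tmB-ren (lifts-ext h) u =
                                     sym (ren-ssub ρ' (tmC R t) _)
  tmC-ren {ρ' = ρ'} h (bang⊗ t u)  rewrite tmC-ren h u | tmB-ren h t = sym (ren-ssub ρ' (tmC R u) _)
  tmC-ren {ρ' = ρ'} h (let!⊗ s t)  rewrite tmC-ren h s | tmC-ren (lifts-ext h) t =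
                                     sym (ren-ssub ρ' (tmC R s) _)
  tmC-ren {ρ' = ρ'} h (abort t)    rewrite tmC-ren h t = sym (ren-ssub ρ' (tmC R t) _)
  tmC-ren {ρ' = ρ'} h (inl t)      rewrite tmC-ren h t = sym (ren-ssub ρ' (tmC R t) _)
  tmC-ren {ρ' = ρ'} h (inr t)      rewrite tmC-ren h t = sym (ren-ssub ρ' (tmC R t) _)
  tmC-ren {ρ' = ρ'} h (case s t u) rewrite tmC-ren h s | tmC-ren h t | tmC-ren h u =
                                     sym (ren-ssub ρ' (tmC R s) _)
  tmC-ren {ρ' = ρ'} h (app s t)    rewrite tmC-ren h t | tmB-ren h s = sym (ren-ssub ρ' (tmC R t) _)

  tmB-wk : ∀ {Γ Γ' A B} (ρ : Ren (ctxB R (Γ , B)) Γ') (t : Tm Γ nothing A) →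
           ren ρ (tmB R (wk {B = B} t)) ≡ ren (λ x → ρ (suc x)) (tmB R t)
  tmB-wk ρ t = trans (cong (ren ρ) (tmB-ren (λ x → refl) t)) (ren-comp (λ x → refl) (tmB R t))

  -- σ^lv = (σ^v)^• : both sides unfold to the same constructors, since
  -- (σ → τ)^v = σ^v → !τ^v  and  (!A)^° = A^• ⇒ R.
  tyLV≡tyB∘tyV : (σ : STy) → tyLV R σ ≡ tyB R (tyV σ)
  tyLV≡tyB∘tyV (base n) = refl
  tyLV≡tyB∘tyV 𝟙ˢ       = refl
  tyLV≡tyB∘tyV (σ ×ˢ τ) = cong₂ _×̇_ (tyLV≡tyB∘tyV σ) (tyLV≡tyB∘tyV τ)
  tyLV≡tyB∘tyV (σ →ˢ τ) =
    cong₂ (λ A B → A ⇒ ((B ⇛ R) ⊸ R)) (tyLV≡tyB∘tyV σ) (tyLV≡tyB∘tyV τ)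

  ctxLV≡ctxB∘ctxV : (Θ : SCtx) → ctxLV R Θ ≡ ctxB R (ctxV Θ)
  ctxLV≡ctxB∘ctxV ∅       = refl
  ctxLV≡ctxB∘ctxV (Θ , σ) = cong₂ _,_ (ctxLV≡ctxB∘ctxV Θ) (tyLV≡tyB∘tyV σ)

  cps : ∀ {Θ σ} → Λ Θ σ → Tm (ctxB R (ctxV Θ)) nothing ((tyB R (tyV σ) ⇛ R) ⊸ R)
  cps (var x)   = λ̂ (svar ∙ var (varB R (varV x)))
  cps ⋆         = λ̂ (svar ∙ ⋆)
  cps ⟨ M , N ⟩ = λ̂ (app (cps M) (λc (app (wk (cps N)) (λc (svar ∙ ⟨ var (suc zero) , var zero ⟩)))))
  cps (π₁ M)    = λ̂ (app (cps M) (λc (svar ∙ π₁ (var zero))))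
  cps (π₂ M)    = λ̂ (app (cps M) (λc (svar ∙ π₂ (var zero))))
  cps (ƛ M)     = λ̂ (svar ∙ ƛ (cps M))
  cps (M · N)   = λ̂ (app (cps M) (λc (app (wk (cps N)) (λc (app (var (suc zero) · var zero) svar)))))

  -- A relation between  cps N  and  (N^v)^•  that holds under every renaming
  -- survives the weakening that pairing and application apply to N.
  weakened : ∀ {Γ Γ' A B} (ρ : Ren (ctxB R (Γ , B)) Γ') {s : Tm (ctxB R Γ) nothing (tyB R A)}
             (t : Tm Γ nothing A) →
             ren (λ x → ρ (suc x)) s ≈ ren (λ x → ρ (suc x)) (tmB R t) →
             ren ρ (wk s) ≈ ren ρ (tmB R (wk {B = B} t))
  weakened ρ {s} t e =
    ≈trans (≡⇒≈ (ren-comp (λ x → refl) s)) (≈trans e (≡⇒≈ (sym (tmB-wk ρ t))))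

  -- Administrative reduction:  (M^v)^•  reduces to  cps M  by β⊸ on the
  -- administrative redexes that  (let !x be t in u)^•  introduces around u^•.
  -- Stated under an arbitrary renaming so that it applies to weakened subterms.
  cps≈tmB∘tmV-ren : ∀ {Θ σ Γ'} (M : Λ Θ σ) (ρ : Ren (ctxB R (ctxV Θ)) Γ') →
                    ren ρ (cps M) ≈ ren ρ (tmB R (tmV M))
  cps≈tmB∘tmV-ren (var x)   ρ = ≈refl
  cps≈tmB∘tmV-ren ⋆         ρ = ≈refl
  cps≈tmB∘tmV-ren (π₁ M)    ρ = cλ̂ (capp (cps≈tmB∘tmV-ren M ρ) (cλc (≈sym (administrative-β _))))
  cps≈tmB∘tmV-ren (π₂ M)    ρ = cλ̂ (capp (cps≈tmB∘tmV-ren M ρ) (cλc (≈sym (administrative-β _))))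
  cps≈tmB∘tmV-ren (ƛ M)     ρ = cλ̂ (c∙ ≈refl (cƛ (cps≈tmB∘tmV-ren M (ext ρ))))
  cps≈tmB∘tmV-ren ⟨ M , N ⟩ ρ =
    cλ̂ (capp (cps≈tmB∘tmV-ren M ρ) (cλc
      (≈trans (capp (weakened (ext ρ) (tmV N) (cps≈tmB∘tmV-ren N (λ x → ext ρ (suc x))))
                    (cλc (≈sym (administrative-β _))))
              (≈sym (administrative-β _)))))
  cps≈tmB∘tmV-ren (M · N)   ρ =
    cλ̂ (capp (cps≈tmB∘tmV-ren M ρ) (cλc
      (≈trans (capp (weakened (ext ρ) (tmV N) (cps≈tmB∘tmV-ren N (λ x → ext ρ (suc x)))) ≈refl)
              (≈sym (administrative-β _)))))

  cps≈tmB∘tmV : ∀ {Θ σ} (M : Λ Θ σ) → cps M ≈ tmB R (tmV M)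
  cps≈tmB∘tmV M = ≈trans (≡⇒≈ (sym (ren-id (λ x → refl) (cps M))))
                    (≈trans (cps≈tmB∘tmV-ren M (λ x → x)) (≡⇒≈ (ren-id (λ x → refl) _)))

  private
    ty≡ : (σ : STy) → tyLV R σ ≡ tyB R (tyV σ)
    ty≡ = tyLV≡tyB∘tyV
    ctx≡ : (Θ : SCtx) → ctxLV R Θ ≡ ctxB R (ctxV Θ)
    ctx≡ = ctxLV≡ctxB∘ctxV
    k≡ : (σ : STy) → (tyLV R σ ⇛ R) ≡ (tyB R (tyV σ) ⇛ R)
    k≡ σ = cong (_⇛ R) (ty≡ σ)
    stoup≡ : (σ : STy) → just (tyLV R σ ⇛ R) ≡ just (tyB R (tyV σ) ⇛ R)
    stoup≡ σ = cong just (k≡ σ)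
    comp≡ : (σ : STy) → ((tyLV R σ ⇛ R) ⊸ R) ≡ ((tyB R (tyV σ) ⇛ R) ⊸ R)
    comp≡ σ = cong (_⊸ R) (k≡ σ)

  varLV≅varB∘varV : ∀ {Θ σ} (x : SVar Θ σ) → varLV R x ≅ varB R (varV x)
  varLV≅varB∘varV {Θ , σ} zero        = ≅-zero (ctx≡ Θ) (ty≡ σ)
  varLV≅varB∘varV {Θ , τ} {σ} (suc x) = ≅-suc (ctx≡ Θ) (ty≡ σ) (ty≡ τ) (varLV≅varB∘varV x)

  var≅ : ∀ {Θ σ} (x : SVar Θ σ) → Tm.var (varLV R x) ≅ Tm.var (varB R (varV x))
  var≅ {Θ} {σ} x = ≅-var (ctx≡ Θ) (ty≡ σ) (varLV≅varB∘varV x)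

  ≅-λ̂k : (Θ : SCtx) (σ : STy) {t : Tm (ctxLV R Θ) (just (tyLV R σ ⇛ R)) ⌜ R ⌝}
         {t' : Tm (ctxB R (ctxV Θ)) (just (tyB R (tyV σ) ⇛ R)) ⌜ R ⌝} → t ≅ t' → λ̂ t ≅ λ̂ t'
  ≅-λ̂k Θ σ = ≅-λ̂ (ctx≡ Θ) (k≡ σ) refl

  ≅-throw : (Θ : SCtx) (σ : STy) {v : Tm (ctxLV R Θ) nothing (tyLV R σ)}
            {v' : Tm (ctxB R (ctxV Θ)) nothing (tyB R (tyV σ))} →
            v ≅ v' → svar {C = tyLV R σ ⇛ R} ∙ v ≅ svar {C = tyB R (tyV σ) ⇛ R} ∙ v'
  ≅-throw Θ σ = ≅-∙ (ctx≡ Θ) (stoup≡ σ) (ty≡ σ) refl (≅-svar (ctx≡ Θ) (k≡ σ))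

  ≅-bind : (Θ : SCtx) (σ ρ : STy)
           {m : Tm (ctxLV R Θ) nothing ((tyLV R ρ ⇛ R) ⊸ R)}
           {m' : Tm (ctxB R (ctxV Θ)) nothing ((tyB R (tyV ρ) ⇛ R) ⊸ R)}
           {b : Tm (ctxLV R (Θ , ρ)) (just (tyLV R σ ⇛ R)) ⌜ R ⌝}
           {b' : Tm (ctxB R (ctxV (Θ , ρ))) (just (tyB R (tyV σ) ⇛ R)) ⌜ R ⌝} →
           m ≅ m' → b ≅ b' → app m (λc b) ≅ app m' (λc b')
  ≅-bind Θ σ ρ m≅ b≅ =
    ≅-app (ctx≡ Θ) (stoup≡ σ) (k≡ ρ) refl m≅ (≅-λc (ctx≡ Θ) (stoup≡ σ) (ty≡ ρ) refl b≅)

  tmLV≅cps : ∀ {Θ σ} (M : Λ Θ σ) → tmLV R M ≅ cps M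
  tmLV≅cps {Θ} {σ} (var x) = ≅-λ̂k Θ σ (≅-throw Θ σ (var≅ x))
  tmLV≅cps {Θ} ⋆           = ≅-λ̂k Θ 𝟙ˢ (≅-throw Θ 𝟙ˢ (≅-⋆ (ctx≡ Θ)))
  tmLV≅cps {Θ} (⟨_,_⟩ {σ} {τ} M N) =
    ≅-λ̂k Θ (σ ×ˢ τ) (≅-bind Θ (σ ×ˢ τ) σ (tmLV≅cps M)
      (≅-bind (Θ , σ) (σ ×ˢ τ) τ (≅-wk (ctx≡ Θ) (comp≡ τ) (ty≡ σ) (tmLV≅cps N))
        (≅-throw ((Θ , σ) , τ) (σ ×ˢ τ)
          (≅-pair (ctx≡ ((Θ , σ) , τ)) (ty≡ σ) (ty≡ τ)
            (var≅ {(Θ , σ) , τ} (suc zero)) (var≅ {(Θ , σ) , τ} zero)))))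
  tmLV≅cps {Θ} (π₁ {σ} {τ} M) =
    ≅-λ̂k Θ σ (≅-bind Θ σ (σ ×ˢ τ) (tmLV≅cps M)
      (≅-throw (Θ , (σ ×ˢ τ)) σ
        (≅-π₁ (ctx≡ (Θ , (σ ×ˢ τ))) (ty≡ σ) (ty≡ τ) (var≅ {Θ , (σ ×ˢ τ)} zero))))
  tmLV≅cps {Θ} (π₂ {σ} {τ} M) =
    ≅-λ̂k Θ τ (≅-bind Θ τ (σ ×ˢ τ) (tmLV≅cps M)
      (≅-throw (Θ , (σ ×ˢ τ)) τ
        (≅-π₂ (ctx≡ (Θ , (σ ×ˢ τ))) (ty≡ σ) (ty≡ τ) (var≅ {Θ , (σ ×ˢ τ)} zero))))
  tmLV≅cps {Θ} (ƛ {σ} {τ} M) =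
    ≅-λ̂k Θ (σ →ˢ τ) (≅-throw Θ (σ →ˢ τ) (≅-ƛ (ctx≡ Θ) (ty≡ σ) (comp≡ τ) (tmLV≅cps M)))
  tmLV≅cps {Θ} {τ} (_·_ {σ} M N) =
    ≅-λ̂k Θ τ (≅-bind Θ τ (σ →ˢ τ) (tmLV≅cps M)
      (≅-bind (Θ , (σ →ˢ τ)) τ σ (≅-wk (ctx≡ Θ) (comp≡ σ) (ty≡ (σ →ˢ τ)) (tmLV≅cps N))
        (≅-app (ctx≡ Θσ) (stoup≡ τ) (k≡ τ) refl
          (≅-· (ctx≡ Θσ) (ty≡ σ) (comp≡ τ) (var≅ {Θσ} (suc zero)) (var≅ {Θσ} zero))
          (≅-svar (ctx≡ Θσ) (k≡ τ)))))
    where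
      Θσ : SCtx
      Θσ = (Θ , (σ →ˢ τ)) , σ

theorem6p1 : (R : CTy) →
    ((σ : STy) → tyLV R σ ≡ tyB R (tyV σ)) ×
    ((Θ : SCtx) → ctxLV R Θ ≡ ctxB R (ctxV Θ)) ×
    (∀ {Θ σ} (M : Λ Θ σ)
       (eΘ : ctxLV R Θ ≡ ctxB R (ctxV Θ)) (eσ : tyLV R σ ≡ tyB R (tyV σ)) →
       tmLV R M ≈ cast (sym eΘ) (cong (λ A → (A ⇛ R) ⊸ R) (sym eσ)) (tmB R (tmV M)))
theorem6p1 R = tyLV≡tyB∘tyV R , ctxLV≡ctxB∘ctxV R , λ M eΘ eσ →
  ≈trans (≡⇒≈ (≅⇒≡cast (tmLV≅cps R M) _ _)) (cast-≈ _ _ (cps≈tmB∘tmV R M))
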